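{- For any matroid $L$ on a set $U$ and any $S\subseteq U$, the identity map on $U$ is a rank-preserving weak map $L|S\mathbin{\Box} L/S\rightarrow L$; that is, every independent set of $L$ is independent in $L|S\mathbin{\Box} L/S$, and the two matroids have the same rank.
   Context: For a matroid $M$ on $S$, $\rho(M)$ is its rank, $\nu_M(A)=|A|-\rho_M(A)$, $\lambda_M(A)=\rho(M)-\rho_M(A)$. For matroids $M$ on $S$ and $N$ on $T$ with $S\cap T=\emptyset$, the free product $M\mathbin{\Box} N$ is the matroid on $S\cup T$ whose independent sets are the $A\subseteq S\cup T$ with $A\cap S$ independent in $M$ and $\lambda_M(A\cap S)\geq\nu_N(A\cap T)$. Here $L|S$ is the restriction to $S$ and $L/S$ the contraction of $S$, a matroid on $U\setminus S$. -}

module Defs where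

open import Data.Nat using (ℕ; zero; suc; _+_; _∸_; _≤_; _<_; _⊔_)
open import Data.Nat.Properties using (_≟_; _≤?_)
open import Data.Bool using (true; false)
open import Data.Vec using ([]; _∷_)
open import Data.List using (List; []; _∷_; map; _++_; foldr)
open import Data.Fin.Subset using (Subset; _⊆_; _∈_; _∉_; _∪_; _∩_; _─_; ∣_∣; ⁅_⁆; ⊥)
open import Data.Fin.Subset.Properties using (_⊆?_)
open import Data.Fin using (Fin)
open import Data.Product using (_×_; _,_; proj₁; ∃-syntax)
open import Relation.Nullary using (Dec; yes; no)
open import Relation.Nullary.Decidable using (_×-dec_)
open import Relation.Binary.PropositionalEquality using (_≡_)

-- All elements live in a finite universe Fin n; a set system / matroid
-- has a ground set E ⊆ Fin n and a decidable family of independent sets,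
-- each contained in E.
record SetSystem (n : ℕ) : Set₁ where
  field
    E      : Subset n
    Indep  : Subset n → Set
    indep? : (A : Subset n) → Dec (Indep A)
    indep⊆E : ∀ {A} → Indep A → A ⊆ E
open SetSystem public

record IsMatroid {n : ℕ} (M : SetSystem n) : Set where
  field
    indep-∅     : Indep M ⊥
    indep-hered : ∀ {A B} → B ⊆ A → Indep M A → Indep M B
    indep-aug   : ∀ {A B} → Indep M A → Indep M B → ∣ A ∣ < ∣ B ∣ →
                  ∃[ x ] (x ∈ B × x ∉ A × Indep M (⁅ x ⁆ ∪ A))

record Matroid (n : ℕ) : Set₁ where
  field
    system    : SetSystem n
    isMatroid : IsMatroid system
open Matroid public

allSubsets : (n : ℕ) → List (Subset n)
allSubsets zero    = [] ∷ []
allSubsets (suc n) = map (true ∷_) (allSubsets n) ++ map (false ∷_) (allSubsets n)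

rk : ∀ {n} → SetSystem n → Subset n → ℕ
rk {n} M A = foldr (λ B r → val B ⊔ r) 0 (allSubsets n)
  where
  val : Subset n → ℕ
  val B with B ⊆? A | indep? M B
  ... | yes _ | yes _ = ∣ B ∣
  ... | _     | _     = 0

rank : ∀ {n} → SetSystem n → ℕ
rank M = rk M (E M)

nullity : ∀ {n} → SetSystem n → Subset n → ℕ
nullity M A = ∣ A ∣ ∸ rk M A

corank : ∀ {n} → SetSystem n → Subset n → ℕ
corank M A = rank M ∸ rk M A

restrict : ∀ {n} → SetSystem n → Subset n → SetSystem n
restrict L S = record
  { E = S
  ; Indep = λ A → A ⊆ S × Indep L A
  ; indep? = λ A → (A ⊆? S) ×-dec indep? L A
  ; indep⊆E = proj₁ }

-- contraction L/S (ground set E ∖ S): A independent iff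
-- ρ_{L/S}(A) = ρ_L(A ∪ S) - ρ_L(S) equals |A|
contract : ∀ {n} → SetSystem n → Subset n → SetSystem n
contract L S = record
  { E = E L ─ S
  ; Indep = λ A → A ⊆ (E L ─ S) × rk L (A ∪ S) ≡ ∣ A ∣ + rk L S
  ; indep? = λ A → (A ⊆? (E L ─ S)) ×-dec (rk L (A ∪ S) ≟ ∣ A ∣ + rk L S)
  ; indep⊆E = proj₁ }

-- free product M □ N (intended for disjoint ground sets) on E M ∪ E N:
-- A independent iff A ∩ E_M independent in M and λ_M(A ∩ E_M) ≥ ν_N(A ∩ E_N)
freeProduct : ∀ {n} → SetSystem n → SetSystem n → SetSystem n
freeProduct M N = record
  { E = E M ∪ E N
  ; Indep = λ A → A ⊆ (E M ∪ E N) × Indep M (A ∩ E M)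
                  × nullity N (A ∩ E N) ≤ corank M (A ∩ E M)
  ; indep? = λ A → (A ⊆? (E M ∪ E N)) ×-dec (indep? M (A ∩ E M)
                  ×-dec (nullity N (A ∩ E N) ≤? corank M (A ∩ E M)))
  ; indep⊆E = proj₁ }

IdWeakMap : ∀ {n} → SetSystem n → SetSystem n → Set
IdWeakMap Src Tgt = ∀ A → Indep Tgt A → Indep Src A

{-# OPTIONS --safe #-}

-- Write ρ for rk. For A ⊆ E(L) with A ∩ S independent, independence in L|S □ L/S
-- reads |A ─ S| − ρ_{L/S}(A ─ S) ≤ ρ(S) − |A ∩ S|, i.e. |A| ≤ ρ_{L/S}(A ─ S) + ρ(S).
-- For A independent in L, augment a maximum independent subset B of S from A to an
-- independent J with |J| ≥ |A|; since J ∩ S ⊇ B already has rank ρ(S), the part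
-- J ─ S is independent in L/S, and this gives the inequality. For the ranks, every
-- free product satisfies ρ(M □ N) ≤ ρ(M) + ρ(N), and ρ(L|S) + ρ(L/S) ≤ ρ(L); the
-- weak map gives the reverse inequality.
module Submission where

open import Defs
open import Function using (_∘_)
open import Data.Nat using (ℕ; zero; suc; _+_; _∸_; _≤_; _<_; _⊔_; z≤n; s≤s)
open import Data.Nat.Properties
open import Data.Vec using ([]; _∷_; here; there)
open import Data.List using ([]; _∷_; map; _++_; foldr)
open import Data.List.Membership.Propositional using () renaming (_∈_ to _∈ₗ_)
open import Data.List.Membership.Propositional.Properties using (∈-map⁺; ∈-++⁺ˡ; ∈-++⁺ʳ)
open import Data.List.Relation.Unary.Any using (here; there)
open import Data.Fin using (Fin; zero)
open import Data.Fin.Subset using (Subset; _⊆_; _∈_; _∉_; _∪_; _∩_; _─_; ∣_∣; ⁅_⁆; ⊥; inside; outside)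
open import Data.Fin.Subset.Properties
open import Data.Product using (_×_; _,_; proj₁; proj₂; ∃-syntax)
open import Data.Sum using (_⊎_; inj₁; inj₂)
open import Data.Empty using (⊥-elim)
open import Relation.Nullary using (¬_; yes; no; contradiction)
open import Relation.Binary.PropositionalEquality using (_≡_; refl; sym; trans; cong; subst)
open ≤-Reasoning

private
  variable
    n : ℕ
    x : Fin n
    p q r : Subset n

x∈p─q⁻ : ∀ (p q : Subset n) → x ∈ p ─ q → x ∈ p × x ∉ q
x∈p─q⁻ (inside ∷ p) (outside ∷ q) here = here , λ ()
x∈p─q⁻ {x = zero} (outside ∷ p) (outside ∷ q) ()
x∈p─q⁻ {x = zero} (_       ∷ p) (inside  ∷ q) ()
x∈p─q⁻ (s ∷ p) (t ∷ q) (there x∈p─q) =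
  let x∈p , x∉q = x∈p─q⁻ p q x∈p─q in there x∈p , x∉q ∘ drop-there

x∈p⇒⁅x⁆⊆p : x ∈ p → ⁅ x ⁆ ⊆ p
x∈p⇒⁅x⁆⊆p {x = x} {p = p} x∈p y∈⁅x⁆ = subst (_∈ p) (sym (x∈⁅y⁆⇒x≡y x y∈⁅x⁆)) x∈p

p⊆r∧q⊆r⇒p∪q⊆r : p ⊆ r → q ⊆ r → p ∪ q ⊆ r
p⊆r∧q⊆r⇒p∪q⊆r {p = p} {q = q} p⊆r q⊆r x∈p∪q with x∈p∪q⁻ p q x∈p∪q
... | inj₁ x∈p = p⊆r x∈p
... | inj₂ x∈q = q⊆r x∈q

p⊆q⇒p─r⊆q─r : p ⊆ q → p ─ r ⊆ q ─ r
p⊆q⇒p─r⊆q─r {p = p} {r = r} p⊆q x∈p─r =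
  let x∈p , x∉r = x∈p─q⁻ p r x∈p─r in x∈p∧x∉q⇒x∈p─q (p⊆q x∈p) x∉r

p⊆q∪r⇒p─q⊆r : p ⊆ q ∪ r → p ─ q ⊆ r
p⊆q∪r⇒p─q⊆r {p = p} {q = q} {r = r} p⊆q∪r x∈p─q with x∈p─q⁻ p q x∈p─q
... | x∈p , x∉q with x∈p∪q⁻ q r (p⊆q∪r x∈p)
...   | inj₁ x∈q = contradiction x∈q x∉q
...   | inj₂ x∈r = x∈r

p⊆[p─q]∪q : ∀ (p q : Subset n) → p ⊆ (p ─ q) ∪ q
p⊆[p─q]∪q p q {x} x∈p with x ∈? q
... | yes x∈q = x∈p∪q⁺ (inj₂ x∈q)
... | no  x∉q = x∈p∪q⁺ (inj₁ (x∈p∧x∉q⇒x∈p─q x∈p x∉q))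

p⊆q∪[p─q] : ∀ (p q : Subset n) → p ⊆ q ∪ (p ─ q)
p⊆q∪[p─q] p q = ⊆-trans (p⊆[p─q]∪q p q) (⊆-reflexive (∪-comm (p ─ q) q))

∣p∣≡∣p─q∣+∣p∩q∣ : ∀ (p q : Subset n) → ∣ p ∣ ≡ ∣ p ─ q ∣ + ∣ p ∩ q ∣
∣p∣≡∣p─q∣+∣p∩q∣ []            []            = refl
∣p∣≡∣p─q∣+∣p∩q∣ (outside ∷ p) (outside ∷ q) = ∣p∣≡∣p─q∣+∣p∩q∣ p q
∣p∣≡∣p─q∣+∣p∩q∣ (outside ∷ p) (inside  ∷ q) = ∣p∣≡∣p─q∣+∣p∩q∣ p q
∣p∣≡∣p─q∣+∣p∩q∣ (inside  ∷ p) (outside ∷ q) = cong suc (∣p∣≡∣p─q∣+∣p∩q∣ p q)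
∣p∣≡∣p─q∣+∣p∩q∣ (inside  ∷ p) (inside  ∷ q) =
  trans (cong suc (∣p∣≡∣p─q∣+∣p∩q∣ p q)) (sym (+-suc ∣ p ─ q ∣ ∣ p ∩ q ∣))

p⊆r⇒p∩[r─q]≡p─q : ∀ (p q r : Subset n) → p ⊆ r → p ∩ (r ─ q) ≡ p ─ q
p⊆r⇒p∩[r─q]≡p─q []            []            []      _   = refl
p⊆r⇒p∩[r─q]≡p─q (outside ∷ p) (outside ∷ q) (_ ∷ r) p⊆r =
  cong (outside ∷_) (p⊆r⇒p∩[r─q]≡p─q p q r (drop-∷-⊆ p⊆r))
p⊆r⇒p∩[r─q]≡p─q (outside ∷ p) (inside  ∷ q) (_ ∷ r) p⊆r =
  cong (outside ∷_) (p⊆r⇒p∩[r─q]≡p─q p q r (drop-∷-⊆ p⊆r))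
p⊆r⇒p∩[r─q]≡p─q (inside  ∷ p) (_ ∷ q) (inside  ∷ r) p⊆r =
  cong (_ ∷_) (p⊆r⇒p∩[r─q]≡p─q p q r (drop-∷-⊆ p⊆r))
p⊆r⇒p∩[r─q]≡p─q (inside  ∷ p) (_ ∷ q) (outside ∷ r) p⊆r with () ← p⊆r here

x∉p⇒∣p∣<∣⁅x⁆∪p∣ : x ∉ p → ∣ p ∣ < ∣ ⁅ x ⁆ ∪ p ∣
x∉p⇒∣p∣<∣⁅x⁆∪p∣ {x = x} {p = p} x∉p =
  p⊂q⇒∣p∣<∣q∣ (q⊆p∪q ⁅ x ⁆ p , x , x∈p∪q⁺ (inj₁ (x∈⁅x⁆ x)) , x∉p)

m+n≤o+p⇒m∸o≤p∸n : ∀ m n o p → m + n ≤ o + p → m ∸ o ≤ p ∸ n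
m+n≤o+p⇒m∸o≤p∸n m       n zero    p m+n≤p    = m+n≤o⇒m≤o∸n m m+n≤p
m+n≤o+p⇒m∸o≤p∸n zero    n (suc o) p _        = z≤n
m+n≤o+p⇒m∸o≤p∸n (suc m) n (suc o) p (s≤s le) = m+n≤o+p⇒m∸o≤p∸n m n o p le

module _ {A : Set} (v : A → ℕ) where

  foldr-⊔-lub : ∀ {m} xs → (∀ x → v x ≤ m) → foldr (λ x r → v x ⊔ r) 0 xs ≤ m
  foldr-⊔-lub []       _     = z≤n
  foldr-⊔-lub (x ∷ xs) bound = ⊔-lub (bound x) (foldr-⊔-lub xs bound)

  foldr-⊔-upper : ∀ {x xs} → x ∈ₗ xs → v x ≤ foldr (λ x r → v x ⊔ r) 0 xs
  foldr-⊔-upper {x} (here refl) = m≤m⊔n (v x) _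
  foldr-⊔-upper {xs = y ∷ _} (there x∈xs) = ≤-trans (foldr-⊔-upper x∈xs) (m≤n⊔m (v y) _)

  foldr-⊔-attained : ∀ xs → let max = foldr (λ x r → v x ⊔ r) 0 xs in
                     max ≡ 0 ⊎ ∃[ x ] max ≡ v x
  foldr-⊔-attained []       = inj₁ refl
  foldr-⊔-attained (x ∷ xs) with ⊔-sel (v x) (foldr (λ x r → v x ⊔ r) 0 xs)
  ... | inj₁ ≡vx = inj₂ (x , ≡vx)
  ... | inj₂ ≡max with foldr-⊔-attained xs
  ...   | inj₁ max≡0       = inj₁ (trans ≡max max≡0)
  ...   | inj₂ (y , max≡vy) = inj₂ (y , trans ≡max max≡vy)

allSubsets-complete : ∀ (p : Subset n) → p ∈ₗ allSubsets n
allSubsets-complete [] = here refl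
allSubsets-complete {suc n} (inside ∷ p) =
  ∈-++⁺ˡ (∈-map⁺ (inside ∷_) (allSubsets-complete p))
allSubsets-complete {suc n} (outside ∷ p) =
  ∈-++⁺ʳ (map (inside ∷_) (allSubsets n)) (∈-map⁺ (outside ∷_) (allSubsets-complete p))

data RankSummand (M : SetSystem n) (X B : Subset n) : ℕ → Set where
  counted   : B ⊆ X → Indep M B → RankSummand M X B ∣ B ∣
  uncounted : ¬ (B ⊆ X × Indep M B) → RankSummand M X B 0

value : ∀ {M : SetSystem n} {X B k} → RankSummand M X B k → ℕ
value {k = k} _ = k

-- `rk` folds over a summand local to its where-block in `Defs`, which cannot
-- be named here; the index `_` of this view is that summand, fixed by `rk≡foldr`.
rankSummand : ∀ (M : SetSystem n) (X B : Subset n) → RankSummand M X B _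

rk≡foldr : ∀ (M : SetSystem n) X → rk M X ≡ foldr (λ B r → value (rankSummand M X B) ⊔ r) 0 (allSubsets n)
rk≡foldr M X = refl

rankSummand M X B with B ⊆? X | indep? M B
... | yes B⊆X | yes indB = counted B⊆X indB
... | yes _   | no ¬indB = uncounted (¬indB ∘ proj₂)
... | no ¬B⊆X | _        = uncounted (¬B⊆X ∘ proj₁)

module _ (M : SetSystem n) where

  private
    weight : Subset n → Subset n → ℕ
    weight X B = value (rankSummand M X B)

  rk-lub : ∀ X {m} → (∀ I → I ⊆ X → Indep M I → ∣ I ∣ ≤ m) → rk M X ≤ m
  rk-lub X {m} bound = foldr-⊔-lub (weight X) (allSubsets n) (λ B → summand≤ (rankSummand M X B))
    where
    summand≤ : ∀ {B k} → RankSummand M X B k → k ≤ m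
    summand≤ (counted B⊆X indB) = bound _ B⊆X indB
    summand≤ (uncounted _)      = z≤n

  indep⇒∣I∣≤rk : ∀ X {I} → I ⊆ X → Indep M I → ∣ I ∣ ≤ rk M X
  indep⇒∣I∣≤rk X {I} I⊆X indI =
    ≤-trans (summand≥ (rankSummand M X I)) (foldr-⊔-upper (weight X) (allSubsets-complete I))
    where
    summand≥ : ∀ {k} → RankSummand M X I k → ∣ I ∣ ≤ k
    summand≥ (counted _ _)  = ≤-refl
    summand≥ (uncounted ¬p) = ⊥-elim (¬p (I⊆X , indI))

  rk-attained : Indep M ⊥ → ∀ X → ∃[ I ] (I ⊆ X × Indep M I × ∣ I ∣ ≡ rk M X)
  rk-attained ind⊥ X = fromMaximum (foldr-⊔-attained (weight X) (allSubsets n))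
    where
    Attained : Set
    Attained = ∃[ I ] (I ⊆ X × Indep M I × ∣ I ∣ ≡ rk M X)

    empty : rk M X ≡ 0 → Attained
    empty rk≡0 = ⊥ , ⊥⊆ , ind⊥ , trans (∣⊥∣≡0 n) (sym rk≡0)

    witness : ∀ {B k} → RankSummand M X B k → rk M X ≡ k → Attained
    witness (counted B⊆X indB) rk≡∣B∣ = _ , B⊆X , indB , sym rk≡∣B∣
    witness (uncounted _)      rk≡0   = empty rk≡0

    fromMaximum : rk M X ≡ 0 ⊎ ∃[ B ] rk M X ≡ weight X B → Attained
    fromMaximum (inj₁ rk≡0)        = empty rk≡0
    fromMaximum (inj₂ (B , rk≡wB)) = witness (rankSummand M X B) rk≡wB

  rk-mono : ∀ {X Y} → X ⊆ Y → rk M X ≤ rk M Y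
  rk-mono {X} {Y} X⊆Y = rk-lub X (λ I I⊆X → indep⇒∣I∣≤rk Y (⊆-trans I⊆X X⊆Y))

  rk≤∣X∣ : ∀ X → rk M X ≤ ∣ X ∣
  rk≤∣X∣ X = rk-lub X (λ I I⊆X _ → p⊆q⇒∣p∣≤∣q∣ I⊆X)

rank-restrict : ∀ (M : SetSystem n) S → rank (restrict M S) ≡ rk M S
rank-restrict M S = ≤-antisym
  (rk-lub (restrict M S) S (λ I I⊆S (_ , indI) → indep⇒∣I∣≤rk M S I⊆S indI))
  (rk-lub M S (λ I I⊆S indI → indep⇒∣I∣≤rk (restrict M S) S I⊆S (I⊆S , indI)))

rank-contract≤ : ∀ (M : SetSystem n) {S} → S ⊆ E M → rank (contract M S) ≤ rank M ∸ rk M S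
rank-contract≤ M {S} S⊆E = rk-lub (contract M S) (E M ─ S) λ C _ (C⊆E─S , rk≡) →
  m+n≤o⇒m≤o∸n ∣ C ∣ (begin
    ∣ C ∣ + rk M S ≡⟨ rk≡ ⟨
    rk M (C ∪ S)   ≤⟨ rk-mono M (p⊆r∧q⊆r⇒p∪q⊆r (⊆-trans C⊆E─S (p─q⊆p (E M) S)) S⊆E) ⟩
    rank M         ∎)

rank-freeProduct≤ : ∀ (M N : SetSystem n) → rank (freeProduct M N) ≤ rank M + rank N
rank-freeProduct≤ {n} M N = rk-lub (freeProduct M N) (E M ∪ E N) bound
  where
  bound : ∀ K → K ⊆ E M ∪ E N → Indep (freeProduct M N) K → ∣ K ∣ ≤ rank M + rank N
  bound K K⊆EM∪EN (_ , indKM , ν≤λ) = begin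
    ∣ K ∣                              ≡⟨ ∣p∣≡∣p─q∣+∣p∩q∣ K (E M) ⟩
    ∣ K ─ E M ∣ + ∣ KM ∣               ≤⟨ +-mono-≤ (p⊆q⇒∣p∣≤∣q∣ K─EM⊆KN) (indep⇒∣I∣≤rk M KM ⊆-refl indKM) ⟩
    ∣ KN ∣ + rk M KM                   ≤⟨ +-monoˡ-≤ (rk M KM) (m≤n+m∸n ∣ KN ∣ (rk N KN)) ⟩
    rk N KN + nullity N KN + rk M KM   ≤⟨ +-monoˡ-≤ (rk M KM) (+-mono-≤ (rk-mono N (p∩q⊆q K (E N))) ν≤λ) ⟩
    rank N + corank M KM + rk M KM     ≡⟨ +-assoc (rank N) (corank M KM) (rk M KM) ⟩
    rank N + (corank M KM + rk M KM)   ≡⟨ cong (rank N +_) (m∸n+n≡m (rk-mono M (p∩q⊆q K (E M)))) ⟩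
    rank N + rank M                    ≡⟨ +-comm (rank N) (rank M) ⟩
    rank M + rank N                    ∎
    where
    KM KN : Subset n
    KM = K ∩ E M
    KN = K ∩ E N
    K─EM⊆KN : K ─ E M ⊆ KN
    K─EM⊆KN x∈K─EM = x∈p∩q⁺ (p─q⊆p K (E M) x∈K─EM , p⊆q∪r⇒p─q⊆r K⊆EM∪EN x∈K─EM)

IdWeakMap⇒rank≤ : ∀ {Src Tgt : SetSystem n} → Indep Tgt ⊥ → E Tgt ⊆ E Src →
                  IdWeakMap Src Tgt → rank Tgt ≤ rank Src
IdWeakMap⇒rank≤ {Src = Src} {Tgt} ind⊥ ET⊆ES weakMap with rk-attained Tgt ind⊥ (E Tgt)
... | B , B⊆ET , indB , ∣B∣≡rank = begin
  rank Tgt ≡⟨ ∣B∣≡rank ⟨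
  ∣ B ∣    ≤⟨ indep⇒∣I∣≤rk Src (E Src) (⊆-trans B⊆ET ET⊆ES) (weakMap B indB) ⟩
  rank Src ∎

module _ (L : Matroid n) where

  private
    M : SetSystem n
    M = system L

  open IsMatroid (isMatroid L)

  indep-extend : ∀ {I K} → Indep M I → Indep M K →
                 ∃[ J ] (I ⊆ J × J ⊆ I ∪ K × Indep M J × ∣ K ∣ ≤ ∣ J ∣)
  indep-extend {I} {K} indI indK = go ∣ K ∣ indI (m≤m+n ∣ K ∣ ∣ I ∣)
    where
    go : ∀ g {I} → Indep M I → ∣ K ∣ ≤ g + ∣ I ∣ →
         ∃[ J ] (I ⊆ J × J ⊆ I ∪ K × Indep M J × ∣ K ∣ ≤ ∣ J ∣)
    go g {I} indI bound with ∣ K ∣ ≤? ∣ I ∣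
    go g       {I} indI bound | yes ∣K∣≤∣I∣ = I , ⊆-refl , p⊆p∪q K , indI , ∣K∣≤∣I∣
    go zero    {I} indI bound | no  ∣K∣≰∣I∣ = contradiction bound ∣K∣≰∣I∣
    go (suc g) {I} indI bound | no  ∣K∣≰∣I∣ with indep-aug indI indK (≰⇒> ∣K∣≰∣I∣)
    ... | x , x∈K , x∉I , indI′ with go g indI′ (begin
          ∣ K ∣                ≤⟨ bound ⟩
          suc (g + ∣ I ∣)      ≡⟨ +-suc g ∣ I ∣ ⟨
          g + suc ∣ I ∣        ≤⟨ +-monoʳ-≤ g (x∉p⇒∣p∣<∣⁅x⁆∪p∣ x∉I) ⟩
          g + ∣ ⁅ x ⁆ ∪ I ∣    ∎)
    ...   | J , I′⊆J , J⊆I′∪K , indJ , ∣K∣≤∣J∣ =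
          J , ⊆-trans (q⊆p∪q ⁅ x ⁆ I) I′⊆J , ⊆-trans J⊆I′∪K I′∪K⊆I∪K , indJ , ∣K∣≤∣J∣
      where
      I′∪K⊆I∪K : (⁅ x ⁆ ∪ I) ∪ K ⊆ I ∪ K
      I′∪K⊆I∪K = p⊆r∧q⊆r⇒p∪q⊆r (p⊆r∧q⊆r⇒p∪q⊆r (x∈p⇒⁅x⁆⊆p (x∈p∪q⁺ (inj₂ x∈K))) (p⊆p∪q K)) (q⊆p∪q I K)

  rk[X∪Y]≤∣X∣+rk[Y] : ∀ X Y → rk M (X ∪ Y) ≤ ∣ X ∣ + rk M Y
  rk[X∪Y]≤∣X∣+rk[Y] X Y = rk-lub M (X ∪ Y) λ I I⊆X∪Y indI → begin
    ∣ I ∣                 ≡⟨ ∣p∣≡∣p─q∣+∣p∩q∣ I X ⟩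
    ∣ I ─ X ∣ + ∣ I ∩ X ∣ ≤⟨ +-mono-≤ (indep⇒∣I∣≤rk M Y (p⊆q∪r⇒p─q⊆r I⊆X∪Y) (indep-hered (p─q⊆p I X) indI))
                                     (∣p∩q∣≤∣q∣ I X) ⟩
    rk M Y + ∣ X ∣        ≡⟨ +-comm (rk M Y) ∣ X ∣ ⟩
    ∣ X ∣ + rk M Y        ∎

  ∣I∣≤rk/S[I─S]+rk[S] : ∀ S {I} → Indep M I → ∣ I ∣ ≤ rk (contract M S) (I ─ S) + rk M S
  ∣I∣≤rk/S[I─S]+rk[S] S {I} indI with rk-attained M indep-∅ S
  ... | B , B⊆S , indB , ∣B∣≡rk[S] with indep-extend indB indI
  ... | J , B⊆J , J⊆B∪I , indJ , ∣I∣≤∣J∣ = begin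
    ∣ I ∣                          ≤⟨ ∣I∣≤∣J∣ ⟩
    ∣ J ∣                          ≡⟨ ∣p∣≡∣p─q∣+∣p∩q∣ J S ⟩
    ∣ J ─ S ∣ + ∣ J ∩ S ∣          ≤⟨ +-mono-≤ (indep⇒∣I∣≤rk (contract M S) (I ─ S) J─S⊆I─S indJ─S)
                                              (indep⇒∣I∣≤rk M S (p∩q⊆q J S) (indep-hered (p∩q⊆p J S) indJ)) ⟩
    rk (contract M S) (I ─ S) + rk M S ∎
    where
    J─S⊆I─S : J ─ S ⊆ I ─ S
    J─S⊆I─S y∈J─S with x∈p─q⁻ J S y∈J─S
    ... | y∈J , y∉S with x∈p∪q⁻ B I (J⊆B∪I y∈J)
    ...   | inj₁ y∈B = contradiction (B⊆S y∈B) y∉S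
    ...   | inj₂ y∈I = x∈p∧x∉q⇒x∈p─q y∈I y∉S

    ∣J─S∣+rk[S]≤rk[[J─S]∪S] : ∣ J ─ S ∣ + rk M S ≤ rk M ((J ─ S) ∪ S)
    ∣J─S∣+rk[S]≤rk[[J─S]∪S] = begin
      ∣ J ─ S ∣ + rk M S    ≡⟨ cong (∣ J ─ S ∣ +_) ∣B∣≡rk[S] ⟨
      ∣ J ─ S ∣ + ∣ B ∣     ≤⟨ +-monoʳ-≤ ∣ J ─ S ∣ (p⊆q⇒∣p∣≤∣q∣ (λ y∈B → x∈p∩q⁺ (B⊆J y∈B , B⊆S y∈B))) ⟩
      ∣ J ─ S ∣ + ∣ J ∩ S ∣ ≡⟨ ∣p∣≡∣p─q∣+∣p∩q∣ J S ⟨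
      ∣ J ∣                 ≤⟨ indep⇒∣I∣≤rk M ((J ─ S) ∪ S) (p⊆[p─q]∪q J S) indJ ⟩
      rk M ((J ─ S) ∪ S)    ∎

    indJ─S : Indep (contract M S) (J ─ S)
    indJ─S = p⊆q⇒p─r⊆q─r (indep⊆E M indJ)
           , ≤-antisym (rk[X∪Y]≤∣X∣+rk[Y] (J ─ S) S) ∣J─S∣+rk[S]≤rk[[J─S]∪S]

IdWeakMap-restrict□contract : ∀ (L : Matroid n) S →
  IdWeakMap (freeProduct (restrict (system L) S) (contract (system L) S)) (system L)
IdWeakMap-restrict□contract {n} L S A indA =
  ⊆-trans A⊆E (p⊆q∪[p─q] (E M) S) , (p∩q⊆q A S , indep-hered (p∩q⊆p A S) indA) , ν≤λ
  where
  open IsMatroid (isMatroid L)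

  M R N : SetSystem n
  M = system L
  R = restrict M S
  N = contract M S

  A⊆E : A ⊆ E M
  A⊆E = indep⊆E M indA

  ν≤λ : nullity N (A ∩ (E M ─ S)) ≤ corank R (A ∩ S)
  ν≤λ = begin
    ∣ A ∩ (E M ─ S) ∣ ∸ rk N (A ∩ (E M ─ S)) ≡⟨ cong (λ B → ∣ B ∣ ∸ rk N B) (p⊆r⇒p∩[r─q]≡p─q A S (E M) A⊆E) ⟩
    ∣ A ─ S ∣ ∸ rk N (A ─ S)                 ≤⟨ m+n≤o+p⇒m∸o≤p∸n ∣ A ─ S ∣ ∣ A ∩ S ∣ (rk N (A ─ S)) (rk M S) ∣A∣≤rk/S+rk[S] ⟩
    rk M S ∸ ∣ A ∩ S ∣                       ≤⟨ ∸-monoʳ-≤ (rk M S) (rk≤∣X∣ R (A ∩ S)) ⟩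
    rk M S ∸ rk R (A ∩ S)                    ≡⟨ cong (_∸ rk R (A ∩ S)) (rank-restrict M S) ⟨
    rank R ∸ rk R (A ∩ S)                    ∎
    where
    ∣A∣≤rk/S+rk[S] : ∣ A ─ S ∣ + ∣ A ∩ S ∣ ≤ rk N (A ─ S) + rk M S
    ∣A∣≤rk/S+rk[S] = subst (_≤ rk N (A ─ S) + rk M S) (∣p∣≡∣p─q∣+∣p∩q∣ A S) (∣I∣≤rk/S[I─S]+rk[S] L S indA)

proposition4p2 : ∀ {n : ℕ} (L : Matroid n) (S : Subset n) → S ⊆ E (system L) →
    IdWeakMap (freeProduct (restrict (system L) S) (contract (system L) S)) (system L)
    × rank (freeProduct (restrict (system L) S) (contract (system L) S)) ≡ rank (system L)
proposition4p2 {n} L S S⊆E = weakMap , ≤-antisym rank≤ rank≥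
  where
  M R N : SetSystem n
  M = system L
  R = restrict M S
  N = contract M S

  weakMap : IdWeakMap (freeProduct R N) M
  weakMap = IdWeakMap-restrict□contract L S

  rank≤ : rank (freeProduct R N) ≤ rank M
  rank≤ = begin
    rank (freeProduct R N)     ≤⟨ rank-freeProduct≤ R N ⟩
    rank R + rank N            ≤⟨ +-mono-≤ (≤-reflexive (rank-restrict M S)) (rank-contract≤ M S⊆E) ⟩
    rk M S + (rank M ∸ rk M S) ≡⟨ m+[n∸m]≡n (rk-mono M S⊆E) ⟩
    rank M                     ∎

  rank≥ : rank M ≤ rank (freeProduct R N)
  rank≥ = IdWeakMap⇒rank≤ (IsMatroid.indep-∅ (isMatroid L)) (p⊆q∪[p─q] (E M) S) weakMap
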